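{- Let $D$ be a diagram and $i,c\ge1$ with $(i,c)\notin D$. If every cell moved by $L_{i,c}$ lies in the $(i+1,c)$-initial segment of $D$, then $L_{i,c}$ acts initially on $D$, i.e. $L_{i+1,c}(D)=D$.
   Context: A diagram is a finite subset of $\mathbb{Z}_{>0}\times\mathbb{Z}_{>0}$; $(r,c)$ is the cell in row $r$ (row 1 on top), column $c$. Ladder moves. Let $D$ be a diagram, $i\ge1$, $(r,c)\in D$. A ladder move below row $i$ can be performed at $(r,c)$ if $(r,c+1)\notin D$ and there is $r'$ with $i\le r'<r$ such that $(r',c)\notin D$, $(r',c+1)\notin D$ and $(s,c),(s,c+1)\in D$ for all $r'<s<r$ (such $r'$ is unique). The regular ladder move replaces $D$ by $(D\setminus\{(r,c)\})\cup\{(r',c+1)\}$; the K-ladder move replaces $D$ by $D\cup\{(r',c+1)\}$. Operator $L_{i,c}$. Given $D$, scan the cells of column $c$ in rows $\ge i$ from top to bottom (in the current diagram); whenever the current cell admits a ladder move below row $i$, perform the regular ladder move. After finishing the column, if at least one move was performed, turn the last one into a K-ladder move. The result is $L_{i,c}(D)$; the cells moved by $L_{i,c}$ are the cells of $D$ at which these moves are performed. $L_{i,c}$ acts initially on $D$ if $L_{i+1,c}(D)=D$. The $(i,c)$-initial segment of a diagram $E$ is the set of cells $(r,c)$ such that $(r',c)\in E$ for all $i\le r'\le r$. -}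

module Defs where

open import Data.Nat using (ℕ; zero; suc; _+_; _∸_; _≤_; _≤ᵇ_; _<ᵇ_; _⊔_)
import Data.Nat as ℕ
open import Data.Bool using (Bool; true; false; _∧_; not; if_then_else_)
open import Data.Product using (_×_; _,_; proj₁; proj₂)
open import Data.Product.Properties using (≡-dec)
open import Data.Bool.ListAction using (any; all)
open import Data.List using (List; []; _∷_; filter; applyUpTo; foldr; map)
open import Data.List.Membership.Propositional using (_∈_)
open import Data.Maybe using (Maybe; just; nothing)
open import Relation.Nullary using (¬_)
open import Relation.Nullary.Decidable using (⌊_⌋)
open import Relation.Binary.PropositionalEquality using (_≡_)

-- A cell (r , c): row r (row 1 on top), column c.
Cell : Set
Cell = ℕ × ℕ

-- A diagram: a finite set of cells, represented by a list (duplicates and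
-- order irrelevant; only membership matters).
Diagram : Set
Diagram = List Cell

_≟c_ : (p q : Cell) → Relation.Nullary.Dec (p ≡ q)
_≟c_ = ≡-dec ℕ._≟_ ℕ._≟_

inD : Diagram → ℕ → ℕ → Bool
inD D r c = any (λ p → ⌊ p ≟c (r , c) ⌋) D

Positive : Diagram → Set
Positive D = ∀ r c → inD D r c ≡ true → (1 ≤ r) × (1 ≤ c)

_≐_ : Diagram → Diagram → Set
D ≐ E = ∀ r c → inD D r c ≡ inD E r c

maxRow : Diagram → ℕ
maxRow = foldr (λ p m → proj₁ p ⊔ m) 0

range : ℕ → ℕ → List ℕ
range a b = applyUpTo (λ k → a + k) (b ∸ a)

-- r' witnesses a ladder move below row i at (r , c) in D (other than the
-- conditions on (r,c) itself): i ≤ r' < r, (r',c),(r',c+1) ∉ D, and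
-- (s,c),(s,c+1) ∈ D for all r' < s < r.
isRung : Diagram → ℕ → ℕ → ℕ → ℕ → Bool
isRung D i r c r' =
  (i ≤ᵇ r') ∧ (r' <ᵇ r) ∧ not (inD D r' c) ∧ not (inD D r' (suc c))
  ∧ all (λ s → inD D s c ∧ inD D s (suc c)) (range (suc r') r)

findFirst : (ℕ → Bool) → List ℕ → Maybe ℕ
findFirst p [] = nothing
findFirst p (x ∷ xs) = if p x then just x else findFirst p xs

-- If a ladder move below row i can be performed at (r , c) in D, return the
-- (unique) r'; otherwise nothing.  Candidates r' range over [i , r).
ladderTarget : Diagram → ℕ → ℕ → ℕ → Maybe ℕ
ladderTarget D i r c =
  if inD D r c ∧ not (inD D r (suc c))
  then findFirst (isRung D i r c) (range i r)
  else nothing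

remove : Diagram → ℕ → ℕ → Diagram
remove D r c = filter (λ p → Relation.Nullary.¬? (p ≟c (r , c))) D

regMove : Diagram → ℕ → ℕ → ℕ → Diagram
regMove D r c r' = (r' , suc c) ∷ remove D r c

kMove : Diagram → ℕ → ℕ → ℕ → Diagram
kMove D r c r' = (r' , suc c) ∷ D

-- Scan the given rows (top to bottom) of column c in the current diagram,
-- performing regular ladder moves below row i; the last performed move is a
-- K-ladder move instead.  Returns the resulting diagram and the list of rows r
-- of the moved cells (r , c).
scan : ℕ → ℕ → List ℕ → Diagram → Diagram × List ℕ
scan i c [] D = D , []
scan i c (r ∷ rs) D with ladderTarget D i r c
... | nothing = scan i c rs D
... | just r' with scan i c rs (regMove D r c r')
...   | E , [] = kMove D r c r' , r ∷ []
...   | E , (m ∷ ms) = E , r ∷ m ∷ ms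

-- Rows of column c that are ≥ i and can contain cells: i , … , maxRow D
-- (ladder moves never add cells to column c).
scanRows : Diagram → ℕ → List ℕ
scanRows D i = range i (suc (maxRow D))

L : ℕ → ℕ → Diagram → Diagram
L i c D = proj₁ (scan i c (scanRows D i) D)

movedRows : ℕ → ℕ → Diagram → List ℕ
movedRows i c D = proj₂ (scan i c (scanRows D i) D)

InInitialSegment : Diagram → ℕ → ℕ → ℕ → Set
InInitialSegment E i c r = (i ≤ r) × (∀ r' → i ≤ r' → r' ≤ r → inD E r' c ≡ true)

-- A ladder move of L_{i+1,c} at (r , c) with rung r' ≥ i+1 is also a ladder
-- move below row i.  While L_{i,c} scans column c, the moves it performs in
-- rows above r' do not touch rows ≥ r', so that move stays available until
-- L_{i,c} has moved some cell (m , c) with m > r'.  By hypothesis (m , c) is in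
-- the (i+1,c)-initial segment of D, which would force the rung cell (r' , c)
-- into D.
module Submission where

open import Defs
open import Data.Nat using (ℕ; suc; _+_; _≤_; _<_; _≤ᵇ_; _<ᵇ_; s≤s; _<?_)
open import Data.Nat.Properties
open import Data.Bool using (Bool; true; false; _∧_; _∨_)
open import Data.Bool.Properties using (T-≡; not-¬)
open import Data.Bool.ListAction using (all)
open import Data.Empty using (⊥-elim)
open import Data.Product using (_×_; _,_; proj₁; proj₂; ∃-syntax; uncurry; map₁; map₂)
open import Function.Base using (_∘_)
open import Data.List using (List; []; _∷_)
open import Data.List.Relation.Unary.Any using (here; there; tail)
open import Data.List.Membership.Propositional using (_∈_)
open import Data.List.Membership.Propositional.Properties using (∈-applyUpTo⁺; ∈-applyUpTo⁻)
open import Data.Maybe using (just; nothing)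
open import Function.Bundles using (Equivalence)
open import Relation.Nullary using (¬_; yes; no)
open import Relation.Binary.PropositionalEquality using (_≡_; _≢_; refl; sym; trans; cong; cong₂; subst)

∈-range⁺ : ∀ {a b x} → a ≤ x → x < b → x ∈ range a b
∈-range⁺ {a} {b} a≤x x<b =
  subst (_∈ range a b) (m+[n∸m]≡n a≤x) (∈-applyUpTo⁺ (a +_) (∸-monoˡ-< x<b a≤x))

∈-range⁻ : ∀ {a b x} → x ∈ range a b → a ≤ x × x < b
∈-range⁻ {a} {b} x∈ with ∈-applyUpTo⁻ (a +_) x∈
... | k , k<b∸a , refl = m≤m+n a k , a+k<b
  where
  a≤b : a ≤ b
  a≤b = <⇒≤ (m∸n≢0⇒n<m (m<n⇒n≢0 k<b∸a))
  a+k<b : a + k < b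
  a+k<b = subst (a + k <_) (m+[n∸m]≡n a≤b) (+-monoʳ-< a k<b∸a)

module _ {A : Set} (p : A → Bool) where

  all-true⁺ : ∀ xs → (∀ {x} → x ∈ xs → p x ≡ true) → all p xs ≡ true
  all-true⁺ [] _ = refl
  all-true⁺ (x ∷ xs) px rewrite px (here refl) = all-true⁺ xs (λ y∈ → px (there y∈))

  all-true⁻ : ∀ xs → all p xs ≡ true → ∀ {x} → x ∈ xs → p x ≡ true
  all-true⁻ (y ∷ ys) ok x∈ with p y in py
  all-true⁻ (y ∷ ys) ok (here refl) | true = py
  all-true⁻ (y ∷ ys) ok (there x∈) | true = all-true⁻ ys ok x∈

module _ (p : ℕ → Bool) where

  findFirst-just⁻ : ∀ xs {x} → findFirst p xs ≡ just x → p x ≡ true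
  findFirst-just⁻ (y ∷ ys) found with p y in py
  findFirst-just⁻ (y ∷ ys) refl | true = py
  ... | false = findFirst-just⁻ ys found

  findFirst-nothing⁻ : ∀ xs {x} → findFirst p xs ≡ nothing → x ∈ xs → p x ≡ false
  findFirst-nothing⁻ (y ∷ ys) none x∈ with p y in py
  findFirst-nothing⁻ (y ∷ ys) () x∈ | true
  findFirst-nothing⁻ (y ∷ ys) none (here refl) | false = py
  findFirst-nothing⁻ (y ∷ ys) none (there x∈) | false = findFirst-nothing⁻ ys none x∈

inD-remove-other : ∀ E r c s c' → (s , c') ≢ (r , c) → inD (remove E r c) s c' ≡ inD E s c'
inD-remove-other [] r c s c' _ = refl
inD-remove-other (p ∷ E) r c s c' s≢r with p ≟c (r , c)
... | no _ = cong (_ ∨_) (inD-remove-other E r c s c' s≢r)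
... | yes refl with (r , c) ≟c (s , c')
...   | yes r≡s = ⊥-elim (s≢r (sym r≡s))
...   | no _ = inD-remove-other E r c s c' s≢r

inD-regMove-other : ∀ E r c r' s c' → (s , c') ≢ (r' , suc c) → (s , c') ≢ (r , c) →
  inD (regMove E r c r') s c' ≡ inD E s c'
inD-regMove-other E r c r' s c' s≢r' s≢r with (r' , suc c) ≟c (s , c')
... | yes r'≡s = ⊥-elim (s≢r' (sym r'≡s))
... | no _ = inD-remove-other E r c s c' s≢r

inD⇒≤maxRow : ∀ E {r c} → inD E r c ≡ true → r ≤ maxRow E
inD⇒≤maxRow ((a , b) ∷ E) {r} {c} r∈ with (a , b) ≟c (r , c)
... | yes refl = m≤m⊔n r (maxRow E)
... | no _ = ≤-trans (inD⇒≤maxRow E r∈) (m≤n⊔m a (maxRow E))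

record LadderMove (D : Diagram) (i r c r' : ℕ) : Set where
  field
    cell∈ : inD D r c ≡ true
    right∉ : inD D r (suc c) ≡ false
    i≤r' : i ≤ r'
    r'<r : r' < r
    rung∉ : inD D r' c ≡ false
    rungRight∉ : inD D r' (suc c) ≡ false
    rails∈ : ∀ s → r' < s → s < r → inD D s c ∧ inD D s (suc c) ≡ true

open LadderMove

module _ (D : Diagram) (i r c r' : ℕ) where

  isRung-sound : isRung D i r c r' ≡ true → inD D r c ≡ true → inD D r (suc c) ≡ false →
    LadderMove D i r c r'
  isRung-sound rung cell∈ right∉
    with i ≤ᵇ r' in i≤ᵇr' | r' <ᵇ r in r'<ᵇr | inD D r' c in rung∉ | inD D r' (suc c) in rungRight∉
  ... | true | true | false | false = record
    { cell∈ = cell∈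
    ; right∉ = right∉
    ; i≤r' = ≤ᵇ⇒≤ i r' (Equivalence.from T-≡ i≤ᵇr')
    ; r'<r = <ᵇ⇒< r' r (Equivalence.from T-≡ r'<ᵇr)
    ; rung∉ = rung∉
    ; rungRight∉ = rungRight∉
    ; rails∈ = λ s r'<s s<r → all-true⁻ _ _ rung (∈-range⁺ r'<s s<r)
    }

  isRung-complete : LadderMove D i r c r' → isRung D i r c r' ≡ true
  isRung-complete mv
    rewrite Equivalence.to T-≡ (≤⇒≤ᵇ (i≤r' mv)) | Equivalence.to T-≡ (<⇒<ᵇ (r'<r mv))
          | rung∉ mv | rungRight∉ mv
    = all-true⁺ _ _ (λ s∈ → let r'<s , s<r = ∈-range⁻ s∈ in rails∈ mv _ r'<s s<r)

LadderMove-lower : ∀ {D i j r c r'} → j ≤ i → LadderMove D i r c r' → LadderMove D j r c r'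
LadderMove-lower j≤i mv = record
  { cell∈ = cell∈ mv
  ; right∉ = right∉ mv
  ; i≤r' = ≤-trans j≤i (i≤r' mv)
  ; r'<r = r'<r mv
  ; rung∉ = rung∉ mv
  ; rungRight∉ = rungRight∉ mv
  ; rails∈ = rails∈ mv
  }

ladderTarget-sound : ∀ D i r c {r'} → ladderTarget D i r c ≡ just r' → LadderMove D i r c r'
ladderTarget-sound D i r c {r'} found with inD D r c in cell∈ | inD D r (suc c) in right∉
... | true | false =
  isRung-sound D i r c r' (findFirst-just⁻ (isRung D i r c) (range i r) found) cell∈ right∉

ladderTarget-complete : ∀ D i r c {r'} → LadderMove D i r c r' → ladderTarget D i r c ≢ nothing
ladderTarget-complete D i r c {r'} mv none rewrite cell∈ mv | right∉ mv =
  not-¬ (isRung-complete D i r c r' mv)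
        (findFirst-nothing⁻ (isRung D i r c) (range i r) none (∈-range⁺ (i≤r' mv) (r'<r mv)))

AgreeFrom : ℕ → ℕ → Diagram → Diagram → Set
AgreeFrom c a D E = ∀ s → a ≤ s → inD E s c ≡ inD D s c × inD E s (suc c) ≡ inD D s (suc c)

LadderMove-transport : ∀ {D E i r c r'} → AgreeFrom c r' D E → LadderMove D i r c r' →
  LadderMove E i r c r'
LadderMove-transport {D} {E} {i} {r} {c} {r'} agree mv = record
  { cell∈ = trans (proj₁ (agree r r'≤r)) (cell∈ mv)
  ; right∉ = trans (proj₂ (agree r r'≤r)) (right∉ mv)
  ; i≤r' = i≤r' mv
  ; r'<r = r'<r mv
  ; rung∉ = trans (proj₁ (agree r' ≤-refl)) (rung∉ mv)
  ; rungRight∉ = trans (proj₂ (agree r' ≤-refl)) (rungRight∉ mv)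
  ; rails∈ = λ s r'<s s<r → trans (uncurry (cong₂ _∧_) (agree s (<⇒≤ r'<s))) (rails∈ mv s r'<s s<r)
  }
  where
  r'≤r : r' ≤ r
  r'≤r = <⇒≤ (r'<r mv)

regMove-agreeFrom : ∀ {D E r c t a} → t < r → r < a → AgreeFrom c a D E →
  AgreeFrom c a D (regMove E r c t)
regMove-agreeFrom {D} {E} {r} {c} {t} t<r r<a agree s a≤s =
  trans (inD-regMove-other E r c t s c (s≢t ∘ cong proj₁) (s≢r ∘ cong proj₁)) (proj₁ (agree s a≤s)) ,
  trans (inD-regMove-other E r c t s (suc c) (s≢t ∘ cong proj₁) (s≢r ∘ cong proj₁)) (proj₂ (agree s a≤s))
  where
  r<s : r < s
  r<s = <-≤-trans r<a a≤s
  s≢r : s ≢ r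
  s≢r = >⇒≢ r<s
  s≢t : s ≢ t
  s≢t = >⇒≢ (<-trans t<r r<s)

scan-skip : ∀ i c r rs E → ladderTarget E i r c ≡ nothing → scan i c (r ∷ rs) E ≡ scan i c rs E
scan-skip i c r rs E none rewrite none = refl

scan-moved-step : ∀ i c r rs E {r'} → ladderTarget E i r c ≡ just r' →
  proj₂ (scan i c (r ∷ rs) E) ≡ r ∷ proj₂ (scan i c rs (regMove E r c r'))
scan-moved-step i c r rs E {r'} found rewrite found with scan i c rs (regMove E r c r')
... | _ , [] = refl
... | _ , _ ∷ _ = refl

scan-identity : ∀ i c rs E → (∀ r → ladderTarget E i r c ≡ nothing) → proj₁ (scan i c rs E) ≡ E
scan-identity i c [] E none = refl
scan-identity i c (r ∷ rs) E none =
  trans (cong proj₁ (scan-skip i c r rs E (none r))) (scan-identity i c rs E none)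

L-identity : ∀ i c D → (∀ {r r'} → ¬ LadderMove D i r c r') → L i c D ≡ D
L-identity i c D noMove = scan-identity i c (scanRows D i) D noTarget
  where
  noTarget : ∀ r → ladderTarget D i r c ≡ nothing
  noTarget r with ladderTarget D i r c in found
  ... | nothing = refl
  ... | just r' = ⊥-elim (noMove (ladderTarget-sound D i r c found))

MovedBelow : ℕ → List ℕ → Set
MovedBelow r' ms = ∃[ m ] m ∈ ms × r' < m

scan-moves-below-rung : ∀ {D i r c r'} → LadderMove D i r c r' →
  ∀ rs E → AgreeFrom c r' D E → r ∈ rs → MovedBelow r' (proj₂ (scan i c rs E))
-- Abstracting over ladderTarget E i x c in the type of scan-moved-step as well
-- lets it rewrite the goal after the scan has been unfolded.
scan-moves-below-rung {D} {i} {r} {c} {r'} mv (x ∷ xs) E agree r∈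
  with ladderTarget E i x c in target | scan-moved-step i c x xs E
... | nothing | _ with r∈
...   | here refl = ⊥-elim (ladderTarget-complete E i r c (LadderMove-transport agree mv) target)
...   | there r∈xs = scan-moves-below-rung mv xs E agree r∈xs
scan-moves-below-rung {D} {i} {r} {c} {r'} mv (x ∷ xs) E agree r∈ | just x' | moved-step
  rewrite moved-step refl with r' <? x
... | yes r'<x = x , here refl , r'<x
... | no r'≮x = map₂ (map₁ there) (scan-moves-below-rung mv xs (regMove E x c x') agree' r∈xs)
  where
  move : LadderMove E i x c x'
  move = ladderTarget-sound E i x c target
  x≢r' : x ≢ r'
  x≢r' refl = not-¬ (cell∈ move) (trans (proj₁ (agree r' ≤-refl)) (rung∉ mv))
  x<r' : x < r'
  x<r' = ≤∧≢⇒< (≮⇒≥ r'≮x) x≢r'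
  agree' : AgreeFrom c r' D (regMove E x c x')
  agree' = regMove-agreeFrom {D} {E} (r'<r move) x<r' agree
  r∈xs : r ∈ xs
  r∈xs = tail (>⇒≢ (<-trans x<r' (r'<r mv))) r∈

L-moves-below-rung : ∀ {D i r c r'} → LadderMove D i r c r' → MovedBelow r' (movedRows i c D)
L-moves-below-rung {D} {i} {r} {c} {r'} mv =
  scan-moves-below-rung mv (scanRows D i) D (λ _ _ → refl , refl) r∈rows
  where
  r∈rows : r ∈ scanRows D i
  r∈rows = ∈-range⁺ (≤-trans (i≤r' mv) (<⇒≤ (r'<r mv))) (s≤s (inD⇒≤maxRow D (cell∈ mv)))

lemma5p11 : (D : Diagram) → Positive D → (i c : ℕ) → 1 ≤ i → 1 ≤ c →
    inD D i c ≡ false →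
    (∀ r → r ∈ movedRows i c D → InInitialSegment D (suc i) c r) →
    L (suc i) c D ≐ D
lemma5p11 D _ i c _ _ _ moved∈segment r c' =
  cong (λ E → inD E r c') (L-identity (suc i) c D noLadderMove)
  where
  noLadderMove : ∀ {r r'} → ¬ LadderMove D (suc i) r c r'
  noLadderMove mv with L-moves-below-rung (LadderMove-lower (n≤1+n i) mv)
  ... | m , m∈ , r'<m = not-¬ (proj₂ (moved∈segment m m∈) _ (i≤r' mv) (<⇒≤ r'<m)) (rung∉ mv)
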